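{- Let $1 \le \alpha < 2$ be real and let $n \ge 2$ be an integer. Put $t(k) = (2^{n-1}-1)\lfloor k\alpha\rfloor + k$ for $k \in \mathbb{N}$, $D_1 = \{t(k)\}_{k=1}^\infty$, and $D_j = D_1 \pm 2^{n-2} \pm 2^{n-3}\pm\cdots\pm 2^{n-j}$ for $2 \le j \le n$. Then $D_1,\ldots,D_n$ partition the set of positive integers into $n$ pairwise disjoint sets.
   Context: For a set $X$ of integers and an integer $r$, $X \pm r = \{x+r : x\in X\}\cup\{x-r : x \in X\}$, iterated left to right. -}

module Defs where

open import Level using (0ℓ)
open import Data.Nat as ℕ using (ℕ; suc; _∸_; _^_)
open import Data.Integer as ℤ using (ℤ; +_)
open import Data.Rational as ℚ using (ℚ; _/_)
open import Data.Product using (Σ; ∃; ∃-syntax; _×_; _,_)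
open import Data.Sum using (_⊎_)
open import Data.Empty using (⊥)
open import Relation.Nullary using (¬_)
open import Relation.Binary.PropositionalEquality using (_≡_)

-- A real number, as a (two-sided) Dedekind cut of ℚ:
-- Lower q  means  q < α,   Upper q  means  α < q.
record Real : Set₁ where
  field
    Lower : ℚ → Set
    Upper : ℚ → Set
    lower-inhabited : ∃[ q ] Lower q
    upper-inhabited : ∃[ q ] Upper q
    lower-rounded   : ∀ q → Lower q → ∃[ r ] (q ℚ.< r × Lower r)
    lower-rounded′  : ∀ q r → q ℚ.< r → Lower r → Lower q
    upper-rounded   : ∀ q → Upper q → ∃[ r ] (r ℚ.< q × Upper r)
    upper-rounded′  : ∀ q r → q ℚ.< r → Upper q → Upper r
    disjoint        : ∀ q → Lower q → Upper q → ⊥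
    located         : ∀ q r → q ℚ.< r → Lower q ⊎ Upper r
open Real public

_≤ᵣ_ : ℚ → Real → Set
q ≤ᵣ α = ¬ Upper α q

_<ᵣ_ : Real → ℚ → Set
α <ᵣ q = Upper α q

-- IsFloorMul α k m  :  m = ⌊ k α ⌋   (for k ≥ 1),  i.e.  m ≤ kα < m + 1,
-- written as  m/k ≤ α < (m+1)/k.
IsFloorMul : Real → (k : ℕ) → .{{ℕ.NonZero k}} → ℕ → Set
IsFloorMul α k m = ((+ m) / k) ≤ᵣ α × α <ᵣ ((+ suc m) / k)

t : (n : ℕ) → (fl : ℕ → ℕ) → ℕ → ℤ
t n fl k = + ((2 ^ (n ∸ 1) ∸ 1) ℕ.* fl k ℕ.+ k)

_±_ : (ℤ → Set) → ℤ → (ℤ → Set)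
(X ± r) y = X (y ℤ.- r) ⊎ X (y ℤ.+ r)

D : (n : ℕ) → (fl : ℕ → ℕ) → ℕ → (ℤ → Set)
D n fl 0 y = ⊥
D n fl 1 y = ∃[ k ] (1 ℕ.≤ k × y ≡ t n fl k)
D n fl (suc (suc j)) = D n fl (suc j) ± (+ (2 ^ (n ∸ suc (suc j))))

module Submission where

-- Write n = n′ + 1, N = 2^(n-1), P = N - 1 and T(k) = t(k+1) = P⌊(k+1)α⌋ + k + 1.
--
-- * Since 1 ≤ α < 2, consecutive floors differ by 1 or 2 and ⌊α⌋ = 1, so
--   T(0) = N and every gap T(k+1) - T(k) is N or 2N - 1.
-- * Call u of level j (1 ≤ j ≤ n) if u = 2^(n-j)(2m+1) with m < 2^(j-1): its
--   2-adic valuation is n - j and u < 2^n.  Passing from D_j to D_{j+1} by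
--   ± 2^(n-j-1) turns level j exactly into level j+1, so by induction on j,
--   y ∈ D_j  ⇔  y + N = T(k) + u  for some k and some u of level j.
-- * Positivity: T(k) ≥ N and u > 0.  Covering: bracket y + N between two
--   consecutive T's; the excess u satisfies 0 < u ≤ 2N - 1 < 2^n, so its
--   valuation a gives the index j = n - a.  Disjointness: two representations
--   T(k) + u = T(k′) + u′ with k ≤ k′ force k′ = k, or k′ = k + 1 with gap N,
--   where u = N + u′ has the valuation of u′ < N; the valuation fixes j.

open import Defs
open import Data.Nat using (ℕ; _≤_)
open import Data.Integer as ℤ using (ℤ)
open import Data.Rational using (1ℚ)
open import Data.Product using (∃-syntax; _×_)
open import Relation.Binary.PropositionalEquality using (_≡_)

open import Data.Nat using (zero; suc; _+_; _*_; _∸_; _^_; _<_; _≤?_; _<?_; _≟_; z≤n; s≤s; z<s)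
open import Data.Nat.Properties
open import Data.Nat.Induction using (<-rec)
open import Data.Nat.Tactic.RingSolver using (solve-∀)
import Data.Integer.Properties as ℤₚ
import Data.Integer.Tactic.RingSolver as ℤSolver
import Data.Rational as ℚ
import Data.Rational.Properties as ℚₚ
import Data.Rational.Unnormalised as ℚᵘ
import Data.Rational.Unnormalised.Properties as ℚᵘₚ
open import Data.Product using (_,_; proj₁; proj₂)
open import Data.Sum using (_⊎_; inj₁; inj₂)
open import Data.Empty using (⊥; ⊥-elim)
open import Relation.Binary.PropositionalEquality
  using (refl; sym; trans; cong; subst; subst₂; module ≡-Reasoning)
open import Relation.Binary.Definitions using (tri<; tri≈; tri>)
open import Relation.Nullary using (yes; no; contradiction)

≤ᵣ-<ᵣ⇒< : (α : Real) {q r : ℚ.ℚ} → q ≤ᵣ α → α <ᵣ r → q ℚ.< r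
≤ᵣ-<ᵣ⇒< α {q} {r} q≤α α<r with ℚₚ.<-cmp q r
... | tri< q<r _ _ = q<r
... | tri≈ _ refl _ = ⊥-elim (q≤α α<r)
... | tri> _ _ r<q = ⊥-elim (q≤α (upper-rounded′ α r q r<q α<r))

/-<⇒*-< : ∀ a b c d → (ℤ.+ a ℚ./ suc c) ℚ.< (ℤ.+ b ℚ./ suc d) → a * suc d < b * suc c
/-<⇒*-< a b c d lt
  with ℚᵘₚ.<-respʳ-≃ (ℚₚ.toℚᵘ-fromℚᵘ (ℚᵘ.mkℚᵘ (ℤ.+ b) d))
         (ℚᵘₚ.<-respˡ-≃ (ℚₚ.toℚᵘ-fromℚᵘ (ℚᵘ.mkℚᵘ (ℤ.+ a) c)) (ℚₚ.toℚᵘ-mono-< lt))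
... | ℚᵘ.*<* ad<bc =
  ℤₚ.drop‿+<+ (subst₂ ℤ._<_ (sym (ℤₚ.pos-* a (suc d))) (sym (ℤₚ.pos-* b (suc c))) ad<bc)

-- If K ≤ a and a(K+1) < (b+1)K then a < b: the lower cross-multiplied
-- inequality between ⌊Kα⌋ = a and ⌊(K+1)α⌋ = b, given α ≥ 1.
floor-increases : ∀ a b K → K ≤ a → a * suc K < suc b * K → a < b
floor-increases a b K K≤a lt = ≰⇒> λ b≤a → <⇒≱ (a<K b≤a) K≤a
  where
  open ≤-Reasoning
  a<K : b ≤ a → a < K
  a<K b≤a = +-cancelʳ-< (a * K) a K (begin-strict
    a + a * K   ≡⟨ *-suc a K ⟨
    a * suc K   <⟨ lt ⟩
    suc b * K   ≤⟨ *-monoˡ-≤ K (s≤s b≤a) ⟩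
    K + a * K   ∎)

-- If a < 2K and bK < (a+1)(K+1) then b ≤ a + 2: the upper cross-multiplied
-- inequality between ⌊Kα⌋ = a and ⌊(K+1)α⌋ = b, given α < 2.
floor-increases-by-at-most-two : ∀ a b K → a < 2 * K → b * K < suc a * suc K → b ≤ 2 + a
floor-increases-by-at-most-two a b K a<2K lt = ≮⇒≥ λ 2+a<b → <⇒≱ a<2K (2K≤a 2+a<b)
  where
  open ≤-Reasoning
  expand-left : ∀ x y → (3 + x) * y ≡ 2 * y + suc x * y
  expand-left = solve-∀
  expand-right : suc a * suc K ≡ suc a + suc a * K
  expand-right = *-suc (suc a) K
  2K≤a : 2 + a < b → 2 * K ≤ a
  2K≤a 2+a<b = ≤-pred (+-cancelʳ-< (suc a * K) (2 * K) (suc a) (begin-strict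
    2 * K + suc a * K   ≡⟨ expand-left a K ⟨
    (3 + a) * K         ≤⟨ *-monoˡ-≤ K 2+a<b ⟩
    b * K               <⟨ lt ⟩
    suc a * suc K       ≡⟨ expand-right ⟩
    suc a + suc a * K   ∎))

one-or-two : ∀ {a b} → a < b → b ≤ 2 + a → b ≡ suc a ⊎ b ≡ suc (suc a)
one-or-two {a} {b} a<b b≤2+a with b ≟ suc a
... | yes b≡1+a = inj₁ b≡1+a
... | no b≢1+a = inj₂ (≤-antisym b≤2+a (≤∧≢⇒< a<b (λ e → b≢1+a (sym e))))

module FloorIncrements (α : Real) (1≤α : 1ℚ ≤ᵣ α) (α<2 : α <ᵣ (ℤ.+ 2 ℚ./ 1)) (fl : ℕ → ℕ)
  (isFloor : ∀ k → .{{_ : Data.Nat.NonZero k}} → IsFloorMul α k (fl k)) where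

  cross : ∀ k k′ → fl (suc k) * suc k′ < suc (fl (suc k′)) * suc k
  cross k k′ = /-<⇒*-< (fl (suc k)) (suc (fl (suc k′))) k k′
    (≤ᵣ-<ᵣ⇒< α (proj₁ (isFloor (suc k))) (proj₂ (isFloor (suc k′))))

  k≤fl : ∀ k → suc k ≤ fl (suc k)
  k≤fl k = ≤-pred (subst₂ _<_ (*-identityˡ (suc k)) (*-identityʳ _)
             (/-<⇒*-< 1 (suc (fl (suc k))) 0 k (≤ᵣ-<ᵣ⇒< α 1≤α (proj₂ (isFloor (suc k))))))

  fl<2k : ∀ k → fl (suc k) < 2 * suc k
  fl<2k k = subst (_< 2 * suc k) (*-identityʳ _)
              (/-<⇒*-< (fl (suc k)) 2 k 0 (≤ᵣ-<ᵣ⇒< α (proj₁ (isFloor (suc k))) α<2))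

  fl-1 : fl 1 ≡ 1
  fl-1 = ≤-antisym (≤-pred (fl<2k 0)) (k≤fl 0)

  fl-step : ∀ k → fl (suc (suc k)) ≡ suc (fl (suc k)) ⊎ fl (suc (suc k)) ≡ suc (suc (fl (suc k)))
  fl-step k = one-or-two
    (floor-increases (fl (suc k)) (fl (suc (suc k))) (suc k) (k≤fl k) (cross k (suc k)))
    (floor-increases-by-at-most-two (fl (suc k)) (fl (suc (suc k))) (suc k) (fl<2k k) (cross (suc k) k))

Val : ℕ → ℕ → Set
Val a u = ∃[ m ] (u ≡ 2 ^ a * suc (2 * m))

parity : ∀ u → ∃[ h ] (u ≡ 2 * h ⊎ u ≡ suc (2 * h))
parity zero = 0 , inj₁ refl
parity (suc u) with parity u
... | h , inj₁ u≡2h = h , inj₂ (cong suc u≡2h)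
... | h , inj₂ u≡2h+1 = suc h , inj₁ (trans (cong suc u≡2h+1) (sym (*-suc 2 h)))

val-exists : ∀ u → 0 < u → ∃[ a ] Val a u
val-exists = <-rec (λ u → 0 < u → ∃[ a ] Val a u) by-halving
  where
  by-halving : ∀ u → (∀ {v} → v < u → 0 < v → ∃[ a ] Val a v) → 0 < u → ∃[ a ] Val a u
  by-halving u rec 0<u with parity u
  ... | h , inj₂ u≡odd = 0 , h , trans u≡odd (sym (*-identityˡ _))
  ... | zero , inj₁ refl = contradiction 0<u (<-irrefl refl)
  ... | suc h , inj₁ refl with rec (m<m+n (suc h) z<s) z<s
  ...   | a , m , h≡ = suc a , m , trans (cong (2 *_) h≡) (sym (*-assoc 2 (2 ^ a) _))

val-unique : ∀ {a b u} → Val a u → Val b u → a ≡ b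
val-unique {a} {b} (m , u≡) (m′ , u≡′) = exponents-equal a b (trans (sym u≡) u≡′)
  where
  exponents-equal : ∀ a b → 2 ^ a * suc (2 * m) ≡ 2 ^ b * suc (2 * m′) → a ≡ b
  exponents-equal zero zero _ = refl
  exponents-equal zero (suc b) e = contradiction
    (trans (sym (*-assoc 2 (2 ^ b) (suc (2 * m′)))) (trans (sym e) (*-identityˡ _))) (even≢odd (2 ^ b * suc (2 * m′)) m)
  exponents-equal (suc a) zero e = contradiction
    (trans (sym (*-assoc 2 (2 ^ a) (suc (2 * m)))) (trans e (*-identityˡ _))) (even≢odd (2 ^ a * suc (2 * m)) m′)
  exponents-equal (suc a) (suc b) e = cong suc (exponents-equal a b
    (*-cancelˡ-≡ _ _ 2 (trans (sym (*-assoc 2 (2 ^ a) (suc (2 * m))))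
                               (trans e (*-assoc 2 (2 ^ b) (suc (2 * m′)))))))

val-< : ∀ {a b u} → Val a u → u < 2 ^ b → a < b
val-< {a} {b} (m , refl) u<2^b =
  ≰⇒> λ b≤a → <⇒≱ u<2^b (≤-trans (^-monoʳ-≤ 2 b≤a) (m≤m*n (2 ^ a) (suc (2 * m))))

val-shift : ∀ {c b u} → Val c u → u < 2 ^ b → Val c (2 ^ b + u)
val-shift {c} {b} {u} val@(m , refl) u<2^b with m≤n⇒∃[o]m+o≡n (val-< {c} {b} val u<2^b)
... | r , refl = 2 ^ r + m , (begin
  2 ^ (suc c + r) + 2 ^ c * suc (2 * m)       ≡⟨ cong (λ p → 2 * p + 2 ^ c * suc (2 * m)) (^-distribˡ-+-* 2 c r) ⟩
  2 * (2 ^ c * 2 ^ r) + 2 ^ c * suc (2 * m)   ≡⟨ regroup (2 ^ c) (2 ^ r) m ⟩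
  2 ^ c * suc (2 * (2 ^ r + m))               ∎)
  where
  open ≡-Reasoning
  regroup : ∀ E R m → 2 * (E * R) + E * suc (2 * m) ≡ E * suc (2 * (R + m))
  regroup = solve-∀

odd-< : ∀ {m M} → m < M → suc (2 * m) < 2 * M
odd-< {m} {M} m<M = subst (_≤ 2 * M) (*-suc 2 m) (*-monoʳ-≤ 2 m<M)

2^[a+1+i] : ∀ a i → 2 ^ (a + suc i) ≡ 2 ^ a * (2 * 2 ^ i)
2^[a+1+i] a i = ^-distribˡ-+-* 2 a (suc i)

-- For u = 2^a(2m + 1):  u < 2^(a+1+i)  iff  m < 2^i.  This converts the size
-- bound u < 2^n into the bound on the odd part used to define levels.
odd-below : ∀ a i m → m < 2 ^ i → 2 ^ a * suc (2 * m) < 2 ^ (a + suc i)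
odd-below a i m m<2^i =
  subst (_ <_) (sym (2^[a+1+i] a i)) (*-monoʳ-< (2 ^ a) {{m^n≢0 2 a}} (odd-< m<2^i))

odd-below⁻¹ : ∀ a i m → 2 ^ a * suc (2 * m) < 2 ^ (a + suc i) → m < 2 ^ i
odd-below⁻¹ a i m lt = *-cancelˡ-< 2 m (2 ^ i)
  (<-trans (n<1+n (2 * m)) (*-cancelˡ-< (2 ^ a) _ _ (subst (_ <_) (2^[a+1+i] a i) lt)))

bracket : (f : ℕ → ℕ) → (∀ k → f k < f (suc k)) →
          ∀ x → f 0 < x → ∃[ k ] (f k < x × x ≤ f (suc k))
bracket f increasing (suc x) f0<1+x with f 0 <? x
... | no f0≮x = 0 , f0<1+x ,
      subst (λ z → suc z ≤ f 1) (≤-antisym (≤-pred f0<1+x) (≮⇒≥ f0≮x)) (increasing 0)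
... | yes f0<x with bracket f increasing x f0<x
...   | k , fk<x , x≤fk+1 with suc x ≤? f (suc k)
...     | yes 1+x≤fk+1 = k , m<n⇒m<1+n fk<x , 1+x≤fk+1
...     | no 1+x≰fk+1 = suc k , subst (_< suc x) x≡fk+1 (n<1+n x) ,
          subst (λ z → suc z ≤ f (suc (suc k))) (sym x≡fk+1) (increasing (suc k))
  where
  x≡fk+1 : x ≡ f (suc k)
  x≡fk+1 = ≤-antisym x≤fk+1 (≤-pred (≰⇒> 1+x≰fk+1))

minus-plus : ∀ y e → (y ℤ.- e) ℤ.+ e ≡ y
minus-plus = ℤSolver.solve-∀

+-cancel-pos : ∀ x a e → x ℤ.+ ℤ.+ e ≡ ℤ.+ (a + e) → x ≡ ℤ.+ a
+-cancel-pos x a e eq = begin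
  x                                   ≡⟨ add-sub x (ℤ.+ e) ⟩
  (x ℤ.+ ℤ.+ e) ℤ.- ℤ.+ e             ≡⟨ cong (ℤ._- ℤ.+ e) (trans eq (ℤₚ.pos-+ a e)) ⟩
  (ℤ.+ a ℤ.+ ℤ.+ e) ℤ.- ℤ.+ e         ≡⟨ add-sub (ℤ.+ a) (ℤ.+ e) ⟨
  ℤ.+ a                               ∎
  where
  open ≡-Reasoning
  add-sub : ∀ x e → x ≡ (x ℤ.+ e) ℤ.- e
  add-sub = ℤSolver.solve-∀

swap : ∀ x c e → (x ℤ.+ e) ℤ.+ c ≡ (x ℤ.+ c) ℤ.+ e
swap = ℤSolver.solve-∀

pos-+-assoc : ∀ t u e → ℤ.+ (t + (u + e)) ≡ ℤ.+ (t + u) ℤ.+ ℤ.+ e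
pos-+-assoc t u e = trans (cong ℤ.+_ (sym (+-assoc t u e))) (ℤₚ.pos-+ (t + u) e)

shift : ∀ x c t u e → x ℤ.+ c ≡ ℤ.+ (t + u) → (x ℤ.+ ℤ.+ e) ℤ.+ c ≡ ℤ.+ (t + (u + e))
shift x c t u e eq =
  trans (swap x c (ℤ.+ e)) (trans (cong (ℤ._+ ℤ.+ e) eq) (sym (pos-+-assoc t u e)))

unshift : ∀ x c t u e → (x ℤ.+ ℤ.+ e) ℤ.+ c ≡ ℤ.+ (t + (u + e)) → x ℤ.+ c ≡ ℤ.+ (t + u)
unshift x c t u e eq = +-cancel-pos (x ℤ.+ c) (t + u) e
  (trans (sym (swap x c (ℤ.+ e))) (trans eq (cong ℤ.+_ (sym (+-assoc t u e)))))

module Partition (n′ : ℕ) (fl : ℕ → ℕ) (fl-1 : fl 1 ≡ 1)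
  (fl-step : ∀ k → fl (suc (suc k)) ≡ suc (fl (suc k)) ⊎ fl (suc (suc k)) ≡ suc (suc (fl (suc k))))
  where

  n N P : ℕ
  n = suc n′
  N = 2 ^ n′
  P = N ∸ 1

  -- T k = t(k+1), so D_1 = {T k : k ∈ ℕ}.
  T : ℕ → ℕ
  T k = P * fl (suc k) + suc k

  0<N : 0 < N
  0<N = m^n>0 2 n′

  1+P≡N : suc P ≡ N
  1+P≡N = trans (+-comm 1 P) (m∸n+n≡m 0<N)

  2^n≡N+N : 2 ^ n ≡ N + N
  2^n≡N+N = cong (N +_) (+-identityʳ N)

  T0≡N : T 0 ≡ N
  T0≡N = begin
    P * fl 1 + 1   ≡⟨ cong (λ f → P * f + 1) fl-1 ⟩
    P * 1 + 1      ≡⟨ cong (_+ 1) (*-identityʳ P) ⟩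
    P + 1          ≡⟨ +-comm P 1 ⟩
    suc P          ≡⟨ 1+P≡N ⟩
    N              ∎
    where open ≡-Reasoning

  T-step : ∀ k → T (suc k) ≡ T k + N ⊎ T (suc k) ≡ T k + (N + P)
  T-step k with fl-step k
  ... | inj₁ fl+1 = inj₁ (begin
    P * fl (suc (suc k)) + suc (suc k)   ≡⟨ cong (λ f → P * f + suc (suc k)) fl+1 ⟩
    P * suc (fl (suc k)) + suc (suc k)   ≡⟨ gap-one P (fl (suc k)) k ⟩
    T k + suc P                          ≡⟨ cong (T k +_) 1+P≡N ⟩
    T k + N                              ∎)
    where
    open ≡-Reasoning
    gap-one : ∀ P a k → P * suc a + suc (suc k) ≡ (P * a + suc k) + suc P
    gap-one = solve-∀
  ... | inj₂ fl+2 = inj₂ (begin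
    P * fl (suc (suc k)) + suc (suc k)         ≡⟨ cong (λ f → P * f + suc (suc k)) fl+2 ⟩
    P * suc (suc (fl (suc k))) + suc (suc k)   ≡⟨ gap-two P (fl (suc k)) k ⟩
    T k + (suc P + P)                          ≡⟨ cong (λ z → T k + (z + P)) 1+P≡N ⟩
    T k + (N + P)                              ∎)
    where
    open ≡-Reasoning
    gap-two : ∀ P a k → P * suc (suc a) + suc (suc k) ≡ (P * a + suc k) + (suc P + P)
    gap-two = solve-∀

  T-gap-≥ : ∀ k → T k + N ≤ T (suc k)
  T-gap-≥ k with T-step k
  ... | inj₁ e = ≤-reflexive (sym e)
  ... | inj₂ e = ≤-trans (+-monoʳ-≤ (T k) (m≤m+n N P)) (≤-reflexive (sym e))

  T-gap-≤ : ∀ k → T (suc k) ≤ T k + (N + P)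
  T-gap-≤ k with T-step k
  ... | inj₁ e = ≤-trans (≤-reflexive e) (+-monoʳ-≤ (T k) (m≤m+n N P))
  ... | inj₂ e = ≤-reflexive e

  T-increasing : ∀ k → T k < T (suc k)
  T-increasing k = <-≤-trans (m<m+n (T k) 0<N) (T-gap-≥ k)

  N≤T : ∀ k → N ≤ T k
  N≤T zero = ≤-reflexive (sym T0≡N)
  N≤T (suc k) = ≤-trans (N≤T k) (<⇒≤ (T-increasing k))

  T-grow : ∀ k d → T k + d * N ≤ T (d + k)
  T-grow k zero = ≤-reflexive (+-identityʳ (T k))
  T-grow k (suc d) = begin
    T k + (N + d * N)   ≡⟨ +-comm (T k) (N + d * N) ⟩
    (N + d * N) + T k   ≡⟨ +-assoc N (d * N) (T k) ⟩
    N + (d * N + T k)   ≡⟨ cong (N +_) (+-comm (d * N) (T k)) ⟩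
    N + (T k + d * N)   ≤⟨ +-monoʳ-≤ N (T-grow k d) ⟩
    N + T (d + k)       ≡⟨ +-comm N (T (d + k)) ⟩
    T (d + k) + N       ≤⟨ T-gap-≥ (d + k) ⟩
    T (suc d + k)       ∎
    where open ≤-Reasoning

  Level : ℕ → ℕ → Set
  Level zero u = ⊥
  Level (suc i) u = ∃[ m ] (m < 2 ^ i × u ≡ 2 ^ (n ∸ suc i) * suc (2 * m))

  level-val : ∀ j {u} → Level j u → Val (n ∸ j) u
  level-val (suc i) (m , _ , u≡) = m , u≡

  level-pos : ∀ j {u} → Level j u → 0 < u
  level-pos (suc i) (m , _ , refl) =
    <-≤-trans (m^n>0 2 (n ∸ suc i)) (m≤m*n (2 ^ (n ∸ suc i)) (suc (2 * m)))

  level-< : ∀ j {u} → j ≤ n → Level j u → u < 2 ^ n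
  level-< (suc i) j≤n (m , m<2^i , refl) =
    subst (2 ^ (n ∸ suc i) * suc (2 * m) <_) (cong (2 ^_) (m∸n+n≡m j≤n)) (odd-below (n ∸ suc i) i m m<2^i)

  level-of : ∀ {a u} → Val a u → u < 2 ^ n → ∃[ i ] (suc i ≤ n × Level (suc i) u)
  level-of {a} {u} val@(m , u≡) u<2^n with m≤n⇒∃[o]m+o≡n (val-< {a} {n} val u<2^n)
  ... | i , 1+a+i≡n = i , subst (suc i ≤_) a+1+i≡n (m≤n+m (suc i) a) , m ,
      odd-below⁻¹ a i m (subst₂ _<_ u≡ (cong (2 ^_) (sym a+1+i≡n)) u<2^n) ,
      trans u≡ (cong (λ b → 2 ^ b * suc (2 * m)) (sym n∸[1+i]≡a))
    where
    a+1+i≡n : a + suc i ≡ n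
    a+1+i≡n = trans (+-suc a i) 1+a+i≡n
    n∸[1+i]≡a : n ∸ suc i ≡ a
    n∸[1+i]≡a = trans (cong (_∸ suc i) (sym a+1+i≡n)) (m+n∸n≡m a (suc i))

  level-1 : Level 1 N
  level-1 = 0 , z<s , sym (*-identityʳ N)

  level-1-unique : ∀ {u} → Level 1 u → u ≡ N
  level-1-unique (zero , _ , u≡) = trans u≡ (*-identityʳ N)
  level-1-unique (suc m , s≤s () , _)

  -- One step down in valuation, j → j + 1 with E = 2^(n-j-1): writing a level-j
  -- number as 2E(2m+1), adding or subtracting E yields the level-(j+1) numbers
  -- E(4m+3) and E(4m+1), and every level-(j+1) number arises this way.
  module _ {i : ℕ} (2+i≤n : suc (suc i) ≤ n) where

    E : ℕ
    E = 2 ^ (n ∸ suc (suc i))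

    halve : ∀ m → 2 ^ (n ∸ suc i) * suc (2 * m) ≡ 2 * E * suc (2 * m)
    halve m = cong (λ b → 2 ^ b * suc (2 * m)) (+-∸-assoc 1 (≤-pred 2+i≤n))

    plus-E : ∀ E m → 2 * E * suc (2 * m) + E ≡ E * suc (2 * suc (2 * m))
    plus-E = solve-∀

    minus-E : ∀ E m → E * suc (2 * (2 * m)) + E ≡ 2 * E * suc (2 * m)
    minus-E = solve-∀

    level-+E : ∀ {u} → Level (suc i) u → Level (suc (suc i)) (u + E)
    level-+E (m , m<2^i , u≡) =
      suc (2 * m) , odd-< m<2^i , trans (cong (_+ E) (trans u≡ (halve m))) (plus-E E m)

    level-∸E : ∀ {u} → Level (suc i) u → ∃[ w ] (Level (suc (suc i)) w × u ≡ w + E)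
    level-∸E (m , m<2^i , u≡) =
      E * suc (2 * (2 * m)) , (2 * m , *-monoʳ-< 2 m<2^i , refl) ,
      trans u≡ (trans (halve m) (sym (minus-E E m)))

    level-down : ∀ {w} → Level (suc (suc i)) w → ∃[ u ] (Level (suc i) u × (u ≡ w + E ⊎ w ≡ u + E))
    level-down (m′ , m′<2^[1+i] , w≡) with parity m′
    ... | h , inj₁ refl =
      2 * E * suc (2 * h) , (h , *-cancelˡ-< 2 h (2 ^ i) m′<2^[1+i] , sym (halve h)) ,
      inj₁ (sym (trans (cong (_+ E) w≡) (minus-E E h)))
    ... | h , inj₂ refl =
      2 * E * suc (2 * h) ,
      (h , *-cancelˡ-< 2 h (2 ^ i) (<-trans (n<1+n (2 * h)) m′<2^[1+i]) , sym (halve h)) ,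
      inj₂ (trans w≡ (sym (plus-E E h)))

  Rep : ℕ → ℤ → Set
  Rep j y = ∃[ k ] ∃[ u ] (Level j u × y ℤ.+ ℤ.+ N ≡ ℤ.+ (T k + u))

  D⇒Rep : ∀ j {y} → j ≤ n → D n fl j y → Rep j y
  D⇒Rep (suc zero) _ (suc k , _ , refl) = k , N , level-1 , sym (ℤₚ.pos-+ (T k) N)
  D⇒Rep (suc (suc i)) {y} 2+i≤n (inj₁ d) with D⇒Rep (suc i) (≤-trans (n≤1+n _) 2+i≤n) d
  ... | k , u , lev , eq = k , u + E 2+i≤n , level-+E 2+i≤n lev ,
      subst (λ x → x ℤ.+ ℤ.+ N ≡ _) (minus-plus y (ℤ.+ E 2+i≤n))
        (shift (y ℤ.- ℤ.+ E 2+i≤n) (ℤ.+ N) (T k) u (E 2+i≤n) eq)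
  D⇒Rep (suc (suc i)) {y} 2+i≤n (inj₂ d) with D⇒Rep (suc i) (≤-trans (n≤1+n _) 2+i≤n) d
  ... | k , u , lev , eq with level-∸E 2+i≤n lev
  ...   | w , lev′ , refl = k , w , lev′ , unshift y (ℤ.+ N) (T k) w (E 2+i≤n) eq

  Rep⇒D-step : ∀ i {y} (2+i≤n : suc (suc i) ≤ n) → (∀ {x} → Rep (suc i) x → D n fl (suc i) x) →
               Rep (suc (suc i)) y → D n fl (suc (suc i)) y
  Rep⇒D-step i {y} 2+i≤n Rep⇒D₁ (k , w , lev , eq) with level-down 2+i≤n lev
  ... | u , lev′ , inj₁ refl =
    inj₂ (Rep⇒D₁ (k , w + E 2+i≤n , lev′ , shift y (ℤ.+ N) (T k) w (E 2+i≤n) eq))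
  ... | u , lev′ , inj₂ refl =
    inj₁ (Rep⇒D₁ (k , u , lev′ , unshift (y ℤ.- ℤ.+ E 2+i≤n) (ℤ.+ N) (T k) u (E 2+i≤n)
      (subst (λ x → x ℤ.+ ℤ.+ N ≡ _) (sym (minus-plus y (ℤ.+ E 2+i≤n))) eq)))

  Rep⇒D : ∀ j {y} → j ≤ n → Rep j y → D n fl j y
  Rep⇒D (suc zero) {y} _ (k , u , lev , eq) =
    suc k , s≤s z≤n , +-cancel-pos y (T k) N (trans eq (cong (λ v → ℤ.+ (T k + v)) (level-1-unique lev)))
  Rep⇒D (suc (suc i)) {y} 2+i≤n =
    Rep⇒D-step i {y} 2+i≤n (Rep⇒D (suc i) (≤-trans (n≤1+n _) 2+i≤n))

  -- Every D_j consists of positive integers: y = (T k - N) + u with T k ≥ N, u > 0.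
  positive : (j : ℕ) → 1 ≤ j → j ≤ n → (y : ℤ) → D n fl j y → ℤ.+ 0 ℤ.< y
  positive j _ j≤n y d with D⇒Rep j j≤n d
  ... | k , u , lev , eq with m≤n⇒∃[o]m+o≡n (N≤T k)
  ...   | s , N+s≡Tk = subst (ℤ.+ 0 ℤ.<_) (sym y≡s+u) (ℤ.+<+ (<-≤-trans (level-pos j lev) (m≤n+m u s)))
    where
    regroup : ∀ N s u → (N + s) + u ≡ (s + u) + N
    regroup = solve-∀
    y≡s+u : y ≡ ℤ.+ (s + u)
    y≡s+u = +-cancel-pos y (s + u) N
      (trans eq (cong ℤ.+_ (trans (cong (_+ u) (sym N+s≡Tk)) (regroup N s u))))

  -- Bracketing y + N (y > 0) between consecutive values T k < y + N ≤ T (k+1)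
  -- leaves an excess u with 0 < u ≤ N + P < 2^n.
  excess : ∀ y′ → ∃[ k ] ∃[ u ] (0 < u × u < 2 ^ n × suc y′ + N ≡ T k + u)
  excess y′ with bracket T T-increasing (suc y′ + N) (subst (_< suc y′ + N) (sym T0≡N) (s≤s (m≤n+m N y′)))
  ... | k , Tk<x , x≤Tk+1 with m≤n⇒∃[o]m+o≡n Tk<x
  ...   | o , 1+Tk+o≡x = k , suc o , z<s , u<2^n , sym Tk+u≡x
    where
    Tk+u≡x : T k + suc o ≡ suc y′ + N
    Tk+u≡x = trans (+-suc (T k) o) 1+Tk+o≡x
    u≤N+P : suc o ≤ N + P
    u≤N+P = +-cancelˡ-≤ (T k) (suc o) (N + P) (≤-trans (≤-reflexive Tk+u≡x) (≤-trans x≤Tk+1 (T-gap-≤ k)))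
    u<2^n : suc o < 2 ^ n
    u<2^n = subst (suc o <_) (sym 2^n≡N+N) (≤-<-trans u≤N+P (+-monoʳ-< N (subst (P <_) 1+P≡N (n<1+n P))))

  -- Every positive y lies in some D_j, namely for j = n - (valuation of the excess).
  covering : (y : ℤ) → ℤ.+ 0 ℤ.< y → ∃[ j ] (1 ≤ j × j ≤ n × D n fl j y)
  covering (ℤ.+ zero) (ℤ.+<+ ())
  covering (ℤ.+ suc y′) _ with excess y′
  ... | k , u , 0<u , u<2^n , x≡Tk+u with val-exists u 0<u
  ...   | a , val with level-of {a} val u<2^n
  ...     | i , 1+i≤n , lev = suc i , s≤s z≤n , 1+i≤n ,
            Rep⇒D (suc i) 1+i≤n (k , u , lev , trans (sym (ℤₚ.pos-+ (suc y′) N)) (cong ℤ.+_ x≡Tk+u))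

  index-from-val : ∀ {i j u} → i ≤ n → j ≤ n → Val (n ∸ i) u → Val (n ∸ j) u → i ≡ j
  index-from-val i≤n j≤n vi vj = ∸-cancelˡ-≡ i≤n j≤n (val-unique vi vj)

  -- Two representations T k + u = T k′ + u′ with k ≤ k′ have the same level:
  -- k′ ≥ k + 2, or k′ = k + 1 with gap 2N - 1, would force u ≥ 2N; with gap N,
  -- u = N + u′ has the valuation of u′ < N.
  same-level : ∀ {i j k k′ u u′} → i ≤ n → j ≤ n → k ≤ k′ → Level i u → Level j u′ →
               T k + u ≡ T k′ + u′ → i ≡ j
  same-level {i} {j} {k} {k′} {u} {u′} i≤n j≤n k≤k′ li lj eq with m≤n⇒∃[o]m+o≡n k≤k′
  ... | d , k+d≡k′ = after d (subst (λ k″ → T k + u ≡ T k″ + u′) (sym (trans (+-comm d k) k+d≡k′)) eq)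
    where
    u<N+N : u < N + N
    u<N+N = subst (u <_) 2^n≡N+N (level-< i i≤n li)

    after : ∀ d → T k + u ≡ T (d + k) + u′ → i ≡ j
    after zero e = index-from-val i≤n j≤n (level-val i li)
      (subst (Val (n ∸ j)) (sym (+-cancelˡ-≡ (T k) u u′ e)) (level-val j lj))
    after (suc zero) e with T-step k
    ... | inj₁ gapN = index-from-val i≤n j≤n (level-val i li)
      (subst (Val (n ∸ j)) (sym u≡N+u′) (val-shift {n ∸ j} {n′} (level-val j lj) u′<N))
      where
      u≡N+u′ : u ≡ N + u′
      u≡N+u′ = +-cancelˡ-≡ (T k) u (N + u′) (trans e (trans (cong (_+ u′) gapN) (+-assoc (T k) N u′)))
      u′<N : u′ < N
      u′<N = +-cancelˡ-< N u′ N (subst (_< N + N) u≡N+u′ u<N+N)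
    ... | inj₂ gap2N-1 = contradiction u<N+N (≤⇒≯ N+N≤u)
      where
      u≡N+P+u′ : u ≡ (N + P) + u′
      u≡N+P+u′ = +-cancelˡ-≡ (T k) u ((N + P) + u′)
        (trans e (trans (cong (_+ u′) gap2N-1) (+-assoc (T k) (N + P) u′)))
      N+N≤u : N + N ≤ u
      N+N≤u = subst₂ _≤_ (trans (sym (+-suc N P)) (cong (N +_) 1+P≡N)) (sym u≡N+P+u′)
        (m<m+n (N + P) (level-pos j lj))
    after (suc (suc d)) e = contradiction u<N+N (≤⇒≯ N+N≤u)
      where
      open ≤-Reasoning
      N+N≤u : N + N ≤ u
      N+N≤u = +-cancelˡ-≤ (T k) (N + N) u (begin
        T k + (N + N)                 ≤⟨ +-monoʳ-≤ (T k) (+-monoʳ-≤ N (m≤m+n N (d * N))) ⟩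
        T k + suc (suc d) * N         ≤⟨ T-grow k (suc (suc d)) ⟩
        T (suc (suc d) + k)           ≤⟨ m≤m+n _ u′ ⟩
        T (suc (suc d) + k) + u′      ≡⟨ e ⟨
        T k + u                       ∎)

  pairwise-disjoint : (i j : ℕ) → 1 ≤ i → i ≤ n → 1 ≤ j → j ≤ n → (y : ℤ) →
             D n fl i y → D n fl j y → i ≡ j
  pairwise-disjoint i j _ i≤n _ j≤n y di dj with D⇒Rep i i≤n di | D⇒Rep j j≤n dj
  ... | k , u , li , eq | k′ , u′ , lj , eq′ =
    by-order (≤-total k k′) (ℤₚ.+-injective (trans (sym eq) eq′))
    where
    by-order : k ≤ k′ ⊎ k′ ≤ k → T k + u ≡ T k′ + u′ → i ≡ j
    by-order (inj₁ k≤k′) e = same-level i≤n j≤n k≤k′ li lj e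
    by-order (inj₂ k′≤k) e = sym (same-level j≤n i≤n k′≤k lj li (sym e))

corollary2p6 : (α : Real) → 1ℚ ≤ᵣ α → α <ᵣ (ℤ.+ 2 Data.Rational./ 1) →
    (n : ℕ) → 2 ≤ n →
    (fl : ℕ → ℕ) → (∀ k → .{{_ : Data.Nat.NonZero k}} → IsFloorMul α k (fl k)) →
    ((j : ℕ) → 1 ≤ j → j ≤ n → (y : ℤ) → D n fl j y → ℤ.+ 0 ℤ.< y)
    × ((y : ℤ) → ℤ.+ 0 ℤ.< y → ∃[ j ] (1 ≤ j × j ≤ n × D n fl j y))
    × ((i j : ℕ) → 1 ≤ i → i ≤ n → 1 ≤ j → j ≤ n → (y : ℤ) →
         D n fl i y → D n fl j y → i ≡ j)
corollary2p6 α 1≤α α<2 (suc n′) _ fl isFloor = positive , covering , pairwise-disjoint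
  where
  open FloorIncrements α 1≤α α<2 fl isFloor using (fl-1; fl-step)
  open Partition n′ fl fl-1 fl-step using (positive; covering; pairwise-disjoint)
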